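{- Let $M=(E,\mathcal{I})$ be a matroid of rank $2$, let $t$ be a positive integer, and let $M_0$ denote the set of elements of $E$ of rank $0$. Then $$ar(M,t)=\begin{cases}|E| & \text{if } |E|<|M_0|+2t \text{ or } |E|<|cl(x)|+t \text{ for some } x\in E,\\ |M_0|+t & \text{otherwise.}\end{cases}$$
   Context: All matroids have finite ground sets. $r_M(S)$ denotes the rank of $S\subseteq E$. The closure of $S$ is $cl(S)=\{y\in E: r_M(S\cup\{y\})=r_M(S)\}$, and $cl(x)$ means $cl(\{x\})$. The elements of rank $0$ are the $x\in E$ with $r_M(\{x\})=0$. A coloring of $E$ assigns a color to every element of $E$. A rainbow basis is a basis of $M$ whose elements receive pairwise different colors. The anti-Ramsey number $ar(M,t)$ is the maximum number $m$ such that there exists a coloring of $E$ using exactly $m$ colors which contains no $t$ pairwise disjoint rainbow bases. -}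

module Defs where

open import Data.Nat using (ℕ; _+_; _≤_; _<_)
open import Data.Nat.Properties using (_≟_)
open import Data.Fin using (Fin)
open import Data.Fin.Subset using (Subset; _∪_; _∩_; _⊆_; ⁅_⁆; ⊤; ∣_∣; _∈_)
open import Data.Vec using (tabulate)
open import Data.Product using (Σ; ∃; _×_)
open import Function.Definitions using (Surjective)
open import Relation.Binary.PropositionalEquality using (_≡_)
open import Relation.Nullary using (does)

record Matroid (n : ℕ) : Set where
  field
    r        : Subset n → ℕ
    r-bound  : ∀ X → r X ≤ ∣ X ∣
    r-mono   : ∀ X Y → X ⊆ Y → r X ≤ r Y
    r-submod : ∀ X Y → r (X ∪ Y) + r (X ∩ Y) ≤ r X + r Y

module _ {n : ℕ} (M : Matroid n) where
  open Matroid M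

  rank : ℕ
  rank = r ⊤

  cl : Subset n → Subset n
  cl S = tabulate (λ y → does (r (S ∪ ⁅ y ⁆) ≟ r S))

  M₀ : Subset n
  M₀ = tabulate (λ x → does (r ⁅ x ⁆ ≟ 0))

  IsBasis : Subset n → Set
  IsBasis B = (r B ≡ ∣ B ∣) × (∣ B ∣ ≡ rank)

  IsRainbowBasis : {m : ℕ} → (Fin n → Fin m) → Subset n → Set
  IsRainbowBasis c B =
    IsBasis B × (∀ x y → x ∈ B → y ∈ B → c x ≡ c y → x ≡ y)

  HasDisjointRainbowBases : {m : ℕ} → (Fin n → Fin m) → ℕ → Set
  HasDisjointRainbowBases c t =
    Σ (Fin t → Subset n) λ Bs →
      (∀ i → IsRainbowBasis c (Bs i)) ×
      (∀ i j x → x ∈ Bs i → x ∈ Bs j → i ≡ j)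

  Admissible : ℕ → ℕ → Set
  Admissible t m =
    Σ (Fin n → Fin m) λ c →
      Surjective _≡_ _≡_ c × (HasDisjointRainbowBases c t → Data.Empty.⊥)
    where import Data.Empty

  -- ar(M,t) = v : v is the maximum m with Admissible t m
  ArEq : ℕ → ℕ → Set
  ArEq t v = Admissible t v × (∀ m → Admissible t m → m ≤ v)

  FirstCase : ℕ → Set
  FirstCase t = (n < ∣ M₀ ∣ + 2 Data.Nat.* t) Data.Sum.⊎ (∃ λ x → n < ∣ cl ⁅ x ⁆ ∣ + t)
    where import Data.Sum

-- In rank 2 the bases are exactly the pairs of non-parallel nonloops. In the first case no
-- colouring has t disjoint bases at all, as they would need 2t nonloops and, for every x, t
-- elements outside cl(x); so all n colours can be used. Otherwise, colouring the loops and
-- t − 1 nonloops injectively and all remaining nonloops alike gives |M₀| + t colours and at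
-- most t − 1 disjoint rainbow bases. Conversely, with more than |M₀| + t colours there is a
-- rainbow set R of t + 1 nonloops, and t disjoint rainbow bases are removed one at a time from
-- the set L of nonloops while keeping |L| ≥ 2t, |R| ≥ t + 1 and "every x ∈ L has ≥ t
-- non-parallel partners in L". For the last invariant each removed pair is chosen so that every
-- element with at most t such partners is parallel to one of its two members.

module Submission where

open import Defs
open import Data.Bool using (Bool; true; false; T; not; _∧_; if_then_else_)
open import Data.Bool.Properties using (T-≡)
open import Data.Empty using (⊥; ⊥-elim)
open import Data.Fin using (Fin; zero; suc; toℕ; fromℕ<; splitAt; join)
open import Data.Fin.Properties
  using (any?; join-splitAt; injective⇒≤; toℕ-injective; toℕ-fromℕ<; toℕ<n) renaming (_≟_ to _≟ᶠ_)
import Data.Fin.Properties as Finₚ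
open import Data.Fin.Subset using (Subset; _∪_; _∩_; _⊆_; ⁅_⁆; ⊤; ∣_∣; _∈_)
open import Data.Fin.Subset.Properties
  using (x∈p∪q⁻; x∈p∪q⁺; x∈⁅x⁆; x∈⁅y⁆⇒x≡y; x∈p∩q⁺; ∣⁅x⁆∣≡1; ∣p∣≤∣x∷p∣; ∈⊤)
open import Data.Nat
  using (ℕ; zero; suc; _+_; _*_; _∸_; _⊓_; _≤_; _<_; z≤n; s≤s; s≤s⁻¹; _<ᵇ_; _≤?_; _<?_)
open import Data.Nat.Properties
open import Data.Product using (Σ; ∃; _×_; _,_; proj₁; proj₂)
open import Data.Sum using (_⊎_; inj₁; inj₂; [_,_]′; swap) renaming (map to map-⊎)
open import Data.Unit using (tt)
open import Data.Vec using (_∷_; []; tabulate; lookup)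
open import Data.Vec.Properties using (tabulate∘lookup; lookup⇒[]=; []=⇒lookup)
open import Function using (_∘_; id)
open import Function.Bundles using (Equivalence)
open import Function.Definitions using (Surjective)
open import Relation.Binary.PropositionalEquality
  using (_≡_; refl; sym; trans; cong; cong₂; subst; module ≡-Reasoning)
open import Relation.Nullary using (¬_; Dec; does; yes; no)
open import Relation.Nullary.Decidable using (T?; ¬?; _×-dec_; _⊎-dec_; decidable-stable)

T-∧⁺ : ∀ {a b} → T a → T b → T (a ∧ b)
T-∧⁺ {true} {true} _ _ = tt

T-∧⁻ˡ : ∀ {a b} → T (a ∧ b) → T a
T-∧⁻ˡ {true} _ = tt

T-∧⁻ʳ : ∀ {a b} → T (a ∧ b) → T b
T-∧⁻ʳ {true} h = h

T-not⁺ : ∀ {a} → ¬ T a → T (not a)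
T-not⁺ {true} h = h tt
T-not⁺ {false} _ = tt

T-not⁻ : ∀ {a} → T (not a) → ¬ T a
T-not⁻ {true} () _

does⁻ : ∀ {A : Set} (d : Dec A) → T (does d) → A
does⁻ (yes a) _ = a

does⁺ : ∀ {A : Set} (d : Dec A) → A → T (does d)
does⁺ (yes _) _ = tt
does⁺ (no ¬a) a = ¬a a

not-does⁻ : ∀ {A : Set} (d : Dec A) → T (not (does d)) → ¬ A
not-does⁻ (no ¬a) _ = ¬a

not-does⁺ : ∀ {A : Set} (d : Dec A) → ¬ A → T (not (does d))
not-does⁺ (yes a) ¬a = ¬a a
not-does⁺ (no _)  _  = tt

infixl 7 _∩ᵇ_ _─ᵇ_ _-ᵇ_
infix 4 _⊆ᵇ_

_∩ᵇ_ _─ᵇ_ : ∀ {n} → (Fin n → Bool) → (Fin n → Bool) → Fin n → Bool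
(p ∩ᵇ q) i = p i ∧ q i
(p ─ᵇ q) i = p i ∧ not (q i)

_-ᵇ_ : ∀ {n} → (Fin n → Bool) → Fin n → Fin n → Bool
(p -ᵇ a) i = not (does (i ≟ᶠ a)) ∧ p i

_⊆ᵇ_ : ∀ {n} → (Fin n → Bool) → (Fin n → Bool) → Set
p ⊆ᵇ q = ∀ i → T (p i) → T (q i)

count : ∀ {n} → (Fin n → Bool) → ℕ
count {zero}  p = 0
count {suc n} p = if p zero then suc (count (p ∘ suc)) else count (p ∘ suc)

count-mono : ∀ {n} (p q : Fin n → Bool) → p ⊆ᵇ q → count p ≤ count q
count-mono {zero} p q h = z≤n
count-mono {suc n} p q h with p zero in ep | q zero in eq
... | true  | true  = s≤s (count-mono _ _ (h ∘ suc))
... | true  | false = ⊥-elim (subst T eq (h zero (subst T (sym ep) tt)))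
... | false | true  = m≤n⇒m≤1+n (count-mono _ _ (h ∘ suc))
... | false | false = count-mono _ _ (h ∘ suc)

count-split : ∀ {n} (p q : Fin n → Bool) → count (p ∩ᵇ q) + count (p ─ᵇ q) ≡ count p
count-split {zero} p q = refl
count-split {suc n} p q with p zero | q zero
... | true  | true  = cong suc (count-split (p ∘ suc) (q ∘ suc))
... | true  | false = trans (+-suc _ _) (cong suc (count-split (p ∘ suc) (q ∘ suc)))
... | false | _     = count-split (p ∘ suc) (q ∘ suc)

count-all : ∀ n → count {n} (λ _ → true) ≡ n
count-all zero    = refl
count-all (suc n) = cong suc (count-all n)

count-complement : ∀ {n} (p : Fin n → Bool) → count p + count (not ∘ p) ≡ n
count-complement {n} p = trans (count-split (λ _ → true) p) (count-all n)

count-none : ∀ {n} (p : Fin n → Bool) → (∀ i → ¬ T (p i)) → count p ≡ 0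
count-none {zero} p h = refl
count-none {suc n} p h with p zero in ep
... | true  = ⊥-elim (h zero (subst T (sym ep) tt))
... | false = count-none (p ∘ suc) (h ∘ suc)

count>0⇒nonempty : ∀ {n} (p : Fin n → Bool) → 0 < count p → ∃ λ i → T (p i)
count>0⇒nonempty {suc n} p h with p zero in ep
... | true  = zero , subst T (sym ep) tt
... | false with count>0⇒nonempty (p ∘ suc) h
...   | i , pi = suc i , pi

count≤1 : ∀ {n} (p : Fin n → Bool) → (∀ i j → T (p i) → T (p j) → i ≡ j) → count p ≤ 1
count≤1 {zero} p h = z≤n
count≤1 {suc n} p h with p zero in ep
... | true  = s≤s (≤-reflexive (count-none (p ∘ suc) λ i pi →
                  Finₚ.0≢1+n (h zero (suc i) (subst T (sym ep) tt) pi)))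
... | false = count≤1 (p ∘ suc) λ i j pi pj → Finₚ.suc-injective (h (suc i) (suc j) pi pj)

count-remove : ∀ {n} (p : Fin n → Bool) a → T (p a) → count p ≡ suc (count (p -ᵇ a))
count-remove {suc n} p zero pa with p zero
... | true = refl
count-remove {suc n} p (suc a) pa with p zero
... | true  = cong suc (count-remove (p ∘ suc) a pa)
... | false = count-remove (p ∘ suc) a pa

∈-remove⁺ : ∀ {n} (p : Fin n → Bool) {a i} → ¬ i ≡ a → T (p i) → T ((p -ᵇ a) i)
∈-remove⁺ p {a} {i} i≢a pi with i ≟ᶠ a
... | yes i≡a = ⊥-elim (i≢a i≡a)
... | no _    = pi

∈-remove⁻ : ∀ {n} (p : Fin n → Bool) {a i} → T ((p -ᵇ a) i) → ¬ i ≡ a × T (p i)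
∈-remove⁻ p {a} {i} h with i ≟ᶠ a
... | no i≢a = i≢a , h

∈⇒count>0 : ∀ {n} (p : Fin n → Bool) a → T (p a) → 0 < count p
∈⇒count>0 p a pa = subst (0 <_) (sym (count-remove p a pa)) (s≤s z≤n)

count-remove-absent : ∀ {n} (p : Fin n → Bool) a → ¬ T (p a) → count p ≤ count (p -ᵇ a)
count-remove-absent p a ¬pa = count-mono p (p -ᵇ a) λ i pi → ∈-remove⁺ p (λ { refl → ¬pa pi }) pi

count≤suc-remove : ∀ {n} (p : Fin n → Bool) a → count p ≤ suc (count (p -ᵇ a))
count≤suc-remove p a with T? (p a)
... | yes pa = ≤-reflexive (count-remove p a pa)
... | no ¬pa = m≤n⇒m≤1+n (count-remove-absent p a ¬pa)

count-remove₂ : ∀ {n} (p : Fin n → Bool) a b → count p ≤ 2 + count (p -ᵇ a -ᵇ b)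
count-remove₂ p a b = ≤-trans (count≤suc-remove p a) (s≤s (count≤suc-remove (p -ᵇ a) b))

count-remove₂-absent : ∀ {n} (p : Fin n → Bool) a b → ¬ T (p a) ⊎ ¬ T (p b) →
                       count p ≤ 1 + count (p -ᵇ a -ᵇ b)
count-remove₂-absent p a b (inj₁ ¬pa) =
  ≤-trans (count-remove-absent p a ¬pa) (count≤suc-remove (p -ᵇ a) b)
count-remove₂-absent p a b (inj₂ ¬pb) =
  ≤-trans (count≤suc-remove p a) (s≤s (count-remove-absent (p -ᵇ a) b (¬pb ∘ proj₂ ∘ ∈-remove⁻ p)))

count-< : ∀ {n} {p q : Fin n → Bool} a → p ⊆ᵇ q → T (q a) → ¬ T (p a) → count p < count q
count-< {p = p} {q} a p⊆q qa ¬pa = begin-strict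
  count p              ≤⟨ count-remove-absent p a ¬pa ⟩
  count (p -ᵇ a)       <⟨ s≤s (count-mono (p -ᵇ a) (q -ᵇ a) λ i pi →
                            let i≢a , pi = ∈-remove⁻ p pi in ∈-remove⁺ q i≢a (p⊆q i pi)) ⟩
  suc (count (q -ᵇ a)) ≡⟨ count-remove q a qa ⟨
  count q              ∎
  where open ≤-Reasoning

count≤suc-count─ : ∀ {n} (p q : Fin n → Bool) →
                   (∀ i j → T ((p ∩ᵇ q) i) → T ((p ∩ᵇ q) j) → i ≡ j) →
                   count p ≤ suc (count (p ─ᵇ q))
count≤suc-count─ p q unique = begin
  count p                             ≡⟨ count-split p q ⟨
  count (p ∩ᵇ q) + count (p ─ᵇ q)     ≤⟨ +-monoˡ-≤ _ (count≤1 (p ∩ᵇ q) unique) ⟩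
  suc (count (p ─ᵇ q))                ∎
  where open ≤-Reasoning

two-elements : ∀ {n} (p : Fin n → Bool) → 2 ≤ count p →
               ∃ λ a → ∃ λ b → T (p a) × T (p b) × ¬ a ≡ b
two-elements p 2≤c with a , pa ← count>0⇒nonempty p (≤-trans (s≤s z≤n) 2≤c)
  with b , pb ← count>0⇒nonempty (p -ᵇ a) (s≤s⁻¹ (subst (2 ≤_) (count-remove p a pa) 2≤c))
  = a , b , pa , proj₂ (∈-remove⁻ p pb) , proj₁ (∈-remove⁻ p pb) ∘ sym

injective⇒≤count : ∀ {k n} (p : Fin n → Bool) (f : Fin k → Fin n) →
                   (∀ i j → f i ≡ f j → i ≡ j) → (∀ i → T (p (f i))) → k ≤ count p
injective⇒≤count {zero}  p f inj pf = z≤n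
injective⇒≤count {suc k} p f inj pf = begin
  suc k                         ≤⟨ s≤s (injective⇒≤count (p -ᵇ f zero) (f ∘ suc)
                                     (λ i j e → Finₚ.suc-injective (inj _ _ e))
                                     (λ i → ∈-remove⁺ p (Finₚ.0≢1+n ∘ sym ∘ inj _ _) (pf (suc i)))) ⟩
  suc (count (p -ᵇ f zero))     ≡⟨ count-remove p (f zero) (pf zero) ⟨
  count p                       ∎
  where open ≤-Reasoning

position : ∀ {n} → (Fin n → Bool) → Fin n → ℕ
position {suc n} p zero    = 0
position {suc n} p (suc y) = if p zero then suc (position (p ∘ suc) y) else position (p ∘ suc) y

prefix : ∀ {n} → (Fin n → Bool) → ℕ → Fin n → Bool
prefix p k y = p y ∧ (position p y <ᵇ k)

position<count : ∀ {n} (p : Fin n → Bool) y → T (p y) → position p y < count p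
position<count {suc n} p zero    py with p zero
... | true = s≤s z≤n
position<count {suc n} p (suc y) py with p zero
... | true  = s≤s (position<count (p ∘ suc) y py)
... | false = position<count (p ∘ suc) y py

position-suc : ∀ {n} (p : Fin (suc n) → Bool) {b} y → p zero ≡ b →
               position p (suc y) ≡ (if b then suc (position (p ∘ suc) y) else position (p ∘ suc) y)
position-suc p y refl = refl

position-surjective : ∀ {n} (p : Fin n → Bool) j → j < count p →
                      ∃ λ y → T (p y) × position p y ≡ j
position-surjective {suc n} p j j<c with p zero in ep
position-surjective {suc n} p zero    j<c       | true = zero , subst T (sym ep) tt , refl
position-surjective {suc n} p (suc j) (s≤s j<c) | true
  with y , py , e ← position-surjective (p ∘ suc) j j<c
  = suc y , py , trans (position-suc p y ep) (cong suc e)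
position-surjective {suc n} p j j<c | false
  with y , py , e ← position-surjective (p ∘ suc) j j<c
  = suc y , py , trans (position-suc p y ep) e

count-prefix≤ : ∀ {n} (p : Fin n → Bool) k → count (prefix p k) ≤ k
count-prefix≤ {zero}  p k = z≤n
count-prefix≤ {suc n} p k with p zero
count-prefix≤ {suc n} p zero    | true  = ≤-reflexive (count-none _ λ i → T-∧⁻ʳ {p (suc i)})
count-prefix≤ {suc n} p (suc k) | true  = s≤s (count-prefix≤ (p ∘ suc) k)
count-prefix≤ {suc n} p k       | false = count-prefix≤ (p ∘ suc) k

count-prefix≥ : ∀ {n} (p : Fin n → Bool) k → k ≤ count p → k ≤ count (prefix p k)
count-prefix≥ p zero k≤c = z≤n
count-prefix≥ {suc n} p (suc k) k≤c with p zero
... | true  = s≤s (count-prefix≥ (p ∘ suc) k (s≤s⁻¹ k≤c))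
... | false = count-prefix≥ (p ∘ suc) (suc k) k≤c

∣tabulate∣ : ∀ {n} (p : Fin n → Bool) → ∣ tabulate p ∣ ≡ count p
∣tabulate∣ {zero}  p = refl
∣tabulate∣ {suc n} p with p zero
... | true  = cong suc (∣tabulate∣ (p ∘ suc))
... | false = ∣tabulate∣ (p ∘ suc)

∣∣≡count-lookup : ∀ {n} (B : Subset n) → ∣ B ∣ ≡ count (lookup B)
∣∣≡count-lookup B = trans (cong ∣_∣ (sym (tabulate∘lookup B))) (∣tabulate∣ (lookup B))

∈⇒T-lookup : ∀ {n} {B : Subset n} {x} → x ∈ B → T (lookup B x)
∈⇒T-lookup x∈B = subst T (sym ([]=⇒lookup x∈B)) tt

T-lookup⇒∈ : ∀ {n} {B : Subset n} {x} → T (lookup B x) → x ∈ B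
T-lookup⇒∈ {B = B} {x} h = lookup⇒[]= x B (Equivalence.to T-≡ h)

-- For a rank-2 matroid, L is the set of nonloops and _∥_ is parallelism; a GoodPair is then a
-- rainbow basis.
module TransversalPairs {n m : ℕ} (_∥_ : Fin n → Fin n → Bool) (col : Fin n → Fin m)
  (∥-sym : ∀ x y → T (x ∥ y) → T (y ∥ x))
  (∥-trans : ∀ x y z → T (x ∥ y) → T (y ∥ z) → T (x ∥ z)) where

  nonparallel : (Fin n → Bool) → Fin n → Fin n → Bool
  nonparallel L x = L ─ᵇ (x ∥_)

  Rainbow : (Fin n → Bool) → Set
  Rainbow R = ∀ x y → T (R x) → T (R y) → col x ≡ col y → x ≡ y

  rainbow-avoids-two-colours : ∀ {R} → Rainbow R → 3 ≤ count R → ∀ c₁ c₂ →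
                               ∃ λ r → T (R r) × ¬ col r ≡ c₁ × ¬ col r ≡ c₂
  rainbow-avoids-two-colours {R} rainbow 3≤c c₁ c₂ =
    witness (count>0⇒nonempty R₂ (s≤s⁻¹ (s≤s⁻¹ (≤-trans 3≤c (≤-trans R≤R₁ (s≤s R₁≤R₂))))))
    where
    coloured : Fin m → Fin n → Bool
    coloured c i = does (col i ≟ᶠ c)
    R₁ R₂ : Fin n → Bool
    R₁ = R ─ᵇ coloured c₁
    R₂ = R₁ ─ᵇ coloured c₂
    one-of-colour : ∀ {S} → S ⊆ᵇ R → ∀ c i j →
                    T ((S ∩ᵇ coloured c) i) → T ((S ∩ᵇ coloured c) j) → i ≡ j
    one-of-colour S⊆R c i j hi hj =
      rainbow i j (S⊆R i (T-∧⁻ˡ hi)) (S⊆R j (T-∧⁻ˡ hj))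
        (trans (does⁻ (col i ≟ᶠ c) (T-∧⁻ʳ hi)) (sym (does⁻ (col j ≟ᶠ c) (T-∧⁻ʳ hj))))
    R≤R₁ : count R ≤ suc (count R₁)
    R≤R₁ = count≤suc-count─ R (coloured c₁) (one-of-colour (λ _ h → h) c₁)
    R₁≤R₂ : count R₁ ≤ suc (count R₂)
    R₁≤R₂ = count≤suc-count─ R₁ (coloured c₂) (one-of-colour (λ _ h → T-∧⁻ˡ h) c₂)
    witness : (∃ λ r → T (R₂ r)) → ∃ λ r → T (R r) × ¬ col r ≡ c₁ × ¬ col r ≡ c₂
    witness (r , r∈R₂) = r , T-∧⁻ˡ (T-∧⁻ˡ r∈R₂)
                           , not-does⁻ (col r ≟ᶠ c₁) (T-∧⁻ʳ {R r} (T-∧⁻ˡ r∈R₂))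
                           , not-does⁻ (col r ≟ᶠ c₂) (T-∧⁻ʳ {R₁ r} r∈R₂)

  rainbow-monochromatic : ∀ {R S} → Rainbow R → S ⊆ᵇ R → ∀ c → (∀ y → T (S y) → col y ≡ c) →
                          count S ≤ 1
  rainbow-monochromatic rainbow S⊆R c mono =
    count≤1 _ λ i j si sj → rainbow i j (S⊆R i si) (S⊆R j sj) (trans (mono i si) (sym (mono j sj)))

  record GoodPair (L : Fin n → Bool) : Set where
    constructor goodPair
    field
      fst snd        : Fin n
      fst∈L          : T (L fst)
      snd∈L          : T (L snd)
      fst∦snd        : ¬ T (fst ∥ snd)
      colours-differ : ¬ col fst ≡ col snd

  open GoodPair

  _∈ᵖ_ : ∀ {L} → Fin n → GoodPair L → Set
  x ∈ᵖ P = x ≡ fst P ⊎ x ≡ snd P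

  ∈ᵖ⇒∈L : ∀ {L} (P : GoodPair L) {x} → x ∈ᵖ P → T (L x)
  ∈ᵖ⇒∈L P (inj₁ refl) = fst∈L P
  ∈ᵖ⇒∈L P (inj₂ refl) = snd∈L P

  weaken : ∀ {L L'} → L' ⊆ᵇ L → GoodPair L' → GoodPair L
  weaken L'⊆L (goodPair a b a∈L' b∈L' a∦b ab) = goodPair a b (L'⊆L a a∈L') (L'⊆L b b∈L') a∦b ab

  DisjointGoodPairs : ℕ → (Fin n → Bool) → Set
  DisjointGoodPairs t L = Σ (Fin t → GoodPair L) λ P → ∀ i j x → x ∈ᵖ P i → x ∈ᵖ P j → i ≡ j

  single : ∀ {L} → GoodPair L → DisjointGoodPairs 1 L
  single P = (λ _ → P) , λ { zero zero _ _ _ → refl }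

  extend : ∀ {t L L'} (P : GoodPair L) → L' ⊆ᵇ L → (∀ x → T (L' x) → ¬ x ∈ᵖ P) →
           DisjointGoodPairs t L' → DisjointGoodPairs (suc t) L
  extend {t} {L} {L'} P L'⊆L avoids (Ps , disjoint) = Ps' , disjoint'
    where
    Ps' : Fin (suc t) → GoodPair L
    Ps' zero    = P
    Ps' (suc i) = weaken L'⊆L (Ps i)
    disjoint' : ∀ i j x → x ∈ᵖ Ps' i → x ∈ᵖ Ps' j → i ≡ j
    disjoint' zero    zero    x _    _    = refl
    disjoint' zero    (suc j) x x∈P  x∈Pj = ⊥-elim (avoids x (∈ᵖ⇒∈L (Ps j) x∈Pj) x∈P)
    disjoint' (suc i) zero    x x∈Pi x∈P  = ⊥-elim (avoids x (∈ᵖ⇒∈L (Ps i) x∈Pi) x∈P)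
    disjoint' (suc i) (suc j) x x∈Pi x∈Pj = cong suc (disjoint i j x x∈Pi x∈Pj)

  record Pairable (t : ℕ) (L R : Fin n → Bool) : Set where
    field
      large     : t + t ≤ count L
      spread    : ∀ x → T (L x) → t ≤ count (nonparallel L x)
      R⊆L       : R ⊆ᵇ L
      rainbow   : Rainbow R
      colourful : suc t ≤ count R

  goodPair-from-two-colours : ∀ {L R} → Pairable 1 L R → GoodPair L
  goodPair-from-two-colours {L} {R} H = pair-up (two-elements R colourful)
    where
    open Pairable H
    pair-up : (∃ λ r₁ → ∃ λ r₂ → T (R r₁) × T (R r₂) × ¬ r₁ ≡ r₂) → GoodPair L
    pair-up (r₁ , r₂ , r₁∈R , r₂∈R , r₁≢r₂) with T? (r₁ ∥ r₂)
    ... | no r₁∦r₂ =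
      goodPair r₁ r₂ (R⊆L r₁ r₁∈R) (R⊆L r₂ r₂∈R) r₁∦r₂ (r₁≢r₂ ∘ rainbow r₁ r₂ r₁∈R r₂∈R)
    ... | yes r₁∥r₂ with count>0⇒nonempty (nonparallel L r₁) (spread r₁ (R⊆L r₁ r₁∈R))
    ...   | w , w∈np with col w ≟ᶠ col r₁
    ...     | no  w≁r₁ = goodPair r₁ w (R⊆L r₁ r₁∈R) (T-∧⁻ˡ w∈np) r₁∦w (w≁r₁ ∘ sym)
      where r₁∦w = T-not⁻ (T-∧⁻ʳ {L w} w∈np)
    ...     | yes w~r₁ = goodPair r₂ w (R⊆L r₂ r₂∈R) (T-∧⁻ˡ w∈np) r₂∦w r₂w-colours
      where
      r₂∦w : ¬ T (r₂ ∥ w)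
      r₂∦w r₂∥w = T-not⁻ (T-∧⁻ʳ {L w} w∈np) (∥-trans r₁ r₂ w r₁∥r₂ r₂∥w)
      r₂w-colours : ¬ col r₂ ≡ col w
      r₂w-colours e = r₁≢r₂ (rainbow r₁ r₂ r₁∈R r₂∈R (trans (sym w~r₁) (sym e)))

  -- covers is what keeps `spread` alive: an element with few non-parallel partners loses at most
  -- one of them.
  record Removable (k : ℕ) (L R : Fin n → Bool) : Set where
    field
      pair   : GoodPair L
      snd∉R  : ¬ T (R (snd pair))
      covers : ∀ x → T (L x) → count (nonparallel L x) ≤ k →
               T (x ∥ fst pair) ⊎ T (x ∥ snd pair)

  module Removal {t L R} (H : Pairable (suc (suc t)) L R) (D : Removable (suc (suc t)) L R) where
    open Pairable H
    open Removable D
    a = fst pair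
    b = snd pair

    L' R' : Fin n → Bool
    L' = L -ᵇ a -ᵇ b
    R' = R -ᵇ a

    L'⊆L : L' ⊆ᵇ L
    L'⊆L x x∈L' = proj₂ (∈-remove⁻ L (proj₂ (∈-remove⁻ (L -ᵇ a) x∈L')))

    L'-avoids-pair : ∀ x → T (L' x) → ¬ x ∈ᵖ pair
    L'-avoids-pair x x∈L' x∈pair
      with x≢b , x∈L-a ← ∈-remove⁻ (L -ᵇ a) {b} {x} x∈L'
      with x≢a , _     ← ∈-remove⁻ L {a} {x} x∈L-a
      = [ x≢a , x≢b ]′ x∈pair

    large' : suc t + suc t ≤ count L'
    large' = s≤s⁻¹ (s≤s⁻¹ (begin
      suc (suc (suc t + suc t)) ≡⟨ cong suc (+-suc (suc t) (suc t)) ⟨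
      suc (suc t) + suc (suc t) ≤⟨ large ⟩
      count L                   ≡⟨ count-remove L a (fst∈L pair) ⟩
      suc (count (L -ᵇ a))      ≡⟨ cong suc (count-remove (L -ᵇ a) b b∈L-a) ⟩
      suc (suc (count L'))      ∎))
      where
      open ≤-Reasoning
      b∈L-a : T ((L -ᵇ a) b)
      b∈L-a = ∈-remove⁺ L (colours-differ pair ∘ cong col ∘ sym) (snd∈L pair)

    spread' : ∀ x → T (L' x) → suc t ≤ count (nonparallel L' x)
    spread' x x∈L' = ≤-trans lost-at-most-one (count-mono q' (nonparallel L' x) q'⊆)
      where
      x∈L = L'⊆L x x∈L'
      q q' : Fin n → Bool
      q  = nonparallel L x
      q' = q -ᵇ a -ᵇ b
      q'⊆ : q' ⊆ᵇ nonparallel L' x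
      q'⊆ y y∈q' with y≢b , y∈q-a ← ∈-remove⁻ (q -ᵇ a) y∈q'
                 with y≢a , y∈q   ← ∈-remove⁻ q y∈q-a
        = T-∧⁺ (∈-remove⁺ (L -ᵇ a) y≢b (∈-remove⁺ L y≢a (T-∧⁻ˡ y∈q))) (T-∧⁻ʳ {L y} y∈q)
      lost-at-most-one : suc t ≤ count q'
      lost-at-most-one with suc (suc (suc t)) ≤? count q
      ... | yes loose = s≤s⁻¹ (s≤s⁻¹ (≤-trans loose (count-remove₂ q a b)))
      ... | no tight = s≤s⁻¹ (≤-trans (spread x x∈L) (count-remove₂-absent q a b a-or-b-absent))
        where
        a-or-b-absent : ¬ T (q a) ⊎ ¬ T (q b)
        a-or-b-absent with covers x x∈L (≮⇒≥ tight)
        ... | inj₁ x∥a = inj₁ λ qa → T-not⁻ (T-∧⁻ʳ {L a} qa) x∥a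
        ... | inj₂ x∥b = inj₂ λ qb → T-not⁻ (T-∧⁻ʳ {L b} qb) x∥b

    remaining : Pairable (suc t) L' R'
    remaining = record
      { large     = large'
      ; spread    = spread'
      ; R⊆L       = λ y y∈R' → let y≢a , y∈R = ∈-remove⁻ R y∈R' in
                    ∈-remove⁺ (L -ᵇ a) (λ { refl → snd∉R y∈R }) (∈-remove⁺ L y≢a (R⊆L y y∈R))
      ; rainbow   = λ x y x∈R' y∈R' →
                      rainbow x y (proj₂ (∈-remove⁻ R x∈R')) (proj₂ (∈-remove⁻ R y∈R'))
      ; colourful = s≤s⁻¹ (≤-trans colourful (count≤suc-remove R a))
      }

  module FindRemovable {t L R} (H : Pairable (suc (suc t)) L R) (R-small : count R ≤ suc (suc (suc t)))
    where
    open Pairable H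

    k : ℕ
    k = suc (suc t)

    module Tight (x₀ : Fin n) (x₀∈L : T (L x₀)) (tight : count (nonparallel L x₀) ≤ k) where
      C O : Fin n → Bool
      C = L ∩ᵇ (x₀ ∥_)
      O = nonparallel L x₀

      C-large : k ≤ count C
      C-large = +-cancelʳ-≤ k k (count C) (begin
        k + k                 ≤⟨ large ⟩
        count L               ≡⟨ count-split L (x₀ ∥_) ⟨
        count C + count O     ≤⟨ +-monoʳ-≤ (count C) tight ⟩
        count C + k           ∎)
        where open ≤-Reasoning

      covers : ∀ c o → T (C c) → T (O o) → ∀ x → T (L x) → count (nonparallel L x) ≤ k →
               T (x ∥ c) ⊎ T (x ∥ o)
      covers c o c∈C o∈O x x∈L x-tight with T? (x₀ ∥ x) | T? (x ∥ o)
      ... | yes x₀∥x | _       = inj₁ (∥-trans x x₀ c (∥-sym x₀ x x₀∥x) (T-∧⁻ʳ {L c} c∈C))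
      ... | no _     | yes x∥o = inj₂ x∥o
      ... | no x₀∦x  | no x∦o  = ⊥-elim (<⇒≱ C<np (≤-trans x-tight C-large))
        where
        C⊆np : C ⊆ᵇ nonparallel L x
        C⊆np y y∈C = T-∧⁺ (T-∧⁻ˡ y∈C) (T-not⁺ λ x∥y →
                       x₀∦x (∥-trans x₀ y x (T-∧⁻ʳ {L y} y∈C) (∥-sym x y x∥y)))
        C<np : count C < count (nonparallel L x)
        C<np = count-< o C⊆np (T-∧⁺ (T-∧⁻ˡ o∈O) (T-not⁺ x∦o))
                 (λ o∈C → T-not⁻ (T-∧⁻ʳ {L o} o∈O) (T-∧⁻ʳ {L o} o∈C))

      Good : Fin n → Fin n → Set
      Good c o = T (C c) × T (O o) × ¬ col c ≡ col o × (¬ T (R c) ⊎ ¬ T (R o))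

      removable-from-good : ∀ c o → Good c o → Removable k L R
      removable-from-good c o (c∈C , o∈O , colours , inj₂ o∉R) = record
        { pair   = goodPair c o (T-∧⁻ˡ c∈C) (T-∧⁻ˡ o∈O) c∦o colours
        ; snd∉R  = o∉R
        ; covers = covers c o c∈C o∈O
        }
        where c∦o = λ c∥o → T-not⁻ (T-∧⁻ʳ {L o} o∈O) (∥-trans x₀ c o (T-∧⁻ʳ {L c} c∈C) c∥o)
      removable-from-good c o (c∈C , o∈O , colours , inj₁ c∉R) = record
        { pair   = goodPair o c (T-∧⁻ˡ o∈O) (T-∧⁻ˡ c∈C) o∦c (colours ∘ sym)
        ; snd∉R  = c∉R
        ; covers = λ x x∈L x-tight → swap (covers c o c∈C o∈O x x∈L x-tight)
        }
        where
        o∦c = λ o∥c → T-not⁻ (T-∧⁻ʳ {L o} o∈O) (∥-trans x₀ c o (T-∧⁻ʳ {L c} c∈C) (∥-sym o c o∥c))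

      outsider-not-in-R-impossible : (∀ c o → ¬ Good c o) → ∀ o → T (O o) → ¬ T (R o) → ⊥
      outsider-not-in-R-impossible bad o o∈O o∉R = <⇒≱ colourful R≤k
        where
        C-monochromatic : ∀ c → T (C c) → col c ≡ col o
        C-monochromatic c c∈C = decidable-stable (col c ≟ᶠ col o) λ ne →
          bad c o (c∈C , o∈O , ne , inj₂ o∉R)
        R∩C≤1 : count (R ∩ᵇ (x₀ ∥_)) ≤ 1
        R∩C≤1 = rainbow-monochromatic rainbow (λ y → T-∧⁻ˡ) (col o) λ y h →
                  C-monochromatic y (T-∧⁺ (R⊆L y (T-∧⁻ˡ h)) (T-∧⁻ʳ {R y} h))
        R─C⊆O-o : R ─ᵇ (x₀ ∥_) ⊆ᵇ O -ᵇ o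
        R─C⊆O-o y h =
          ∈-remove⁺ O (λ { refl → o∉R (T-∧⁻ˡ h) }) (T-∧⁺ (R⊆L y (T-∧⁻ˡ h)) (T-∧⁻ʳ {R y} h))
        R≤k : count R ≤ k
        R≤k = begin
          count R                                         ≡⟨ count-split R (x₀ ∥_) ⟨
          count (R ∩ᵇ (x₀ ∥_)) + count (R ─ᵇ (x₀ ∥_))     ≤⟨ +-mono-≤ R∩C≤1 (count-mono _ _ R─C⊆O-o) ⟩
          suc (count (O -ᵇ o))                            ≡⟨ count-remove O o o∈O ⟨
          count O                                         ≤⟨ tight ⟩
          k                                               ∎
          where open ≤-Reasoning

      outsiders-in-R-impossible : (∀ c o → ¬ Good c o) → O ⊆ᵇ R → ⊥
      outsiders-in-R-impossible bad O⊆R = <⇒≱ (≤-trans (s≤s (s≤s z≤n)) (spread x₀ x₀∈L)) O≤1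
        where
        R∩C≤1 : count (R ∩ᵇ (x₀ ∥_)) ≤ 1
        R∩C≤1 = +-cancelʳ-≤ k (count (R ∩ᵇ (x₀ ∥_))) 1 (begin
          count (R ∩ᵇ (x₀ ∥_)) + k                        ≤⟨ +-monoʳ-≤ _ (≤-trans (spread x₀ x₀∈L)
                                                               (count-mono O (R ─ᵇ (x₀ ∥_)) λ y h →
                                                                  T-∧⁺ (O⊆R y h) (T-∧⁻ʳ {L y} h))) ⟩
          count (R ∩ᵇ (x₀ ∥_)) + count (R ─ᵇ (x₀ ∥_))     ≡⟨ count-split R (x₀ ∥_) ⟩
          count R                                         ≤⟨ R-small ⟩
          1 + k                                           ∎)
          where open ≤-Reasoning
        C∩R⊆R∩C : C ∩ᵇ R ⊆ᵇ R ∩ᵇ (x₀ ∥_)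
        C∩R⊆R∩C y h = T-∧⁺ (T-∧⁻ʳ {C y} h) (T-∧⁻ʳ {L y} (T-∧⁻ˡ h))
        C─R-nonempty : 0 < count (C ─ᵇ R)
        C─R-nonempty = +-cancelˡ-≤ 1 1 (count (C ─ᵇ R)) (begin
          2                                 ≤⟨ ≤-trans (s≤s (s≤s z≤n)) C-large ⟩
          count C                           ≡⟨ count-split C R ⟨
          count (C ∩ᵇ R) + count (C ─ᵇ R)   ≤⟨ +-monoˡ-≤ _ (≤-trans (count-mono _ _ C∩R⊆R∩C) R∩C≤1) ⟩
          1 + count (C ─ᵇ R)                ∎)
          where open ≤-Reasoning
        c = proj₁ (count>0⇒nonempty (C ─ᵇ R) C─R-nonempty)
        c∈C─R = proj₂ (count>0⇒nonempty (C ─ᵇ R) C─R-nonempty)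
        O-monochromatic : ∀ o → T (O o) → col o ≡ col c
        O-monochromatic o o∈O = decidable-stable (col o ≟ᶠ col c) λ ne →
          bad c o (T-∧⁻ˡ c∈C─R , o∈O , ne ∘ sym , inj₁ (T-not⁻ (T-∧⁻ʳ {C c} c∈C─R)))
        O≤1 : count O ≤ 1
        O≤1 = rainbow-monochromatic rainbow O⊆R (col c) O-monochromatic

      no-good-pair-impossible : (∀ c o → ¬ Good c o) → ⊥
      no-good-pair-impossible bad with any? (λ o → T? (O o) ×-dec ¬? (T? (R o)))
      ... | yes (o , o∈O , o∉R) = outsider-not-in-R-impossible bad o o∈O o∉R
      ... | no ∄o = outsiders-in-R-impossible bad λ o o∈O →
                      decidable-stable (T? (R o)) λ o∉R → ∄o (o , o∈O , o∉R)

      removable : Removable k L R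
      removable with any? (λ c → any? (λ o → T? (C c) ×-dec T? (O o) ×-dec ¬? (col c ≟ᶠ col o)
                                          ×-dec (¬? (T? (R c)) ⊎-dec ¬? (T? (R o)))))
      ... | yes (c , o , good) = removable-from-good c o good
      ... | no ∄good = ⊥-elim (no-good-pair-impossible λ c o good → ∄good (c , o , good))

    module Slack (slack : ∀ x → T (L x) → k < count (nonparallel L x)) where
      Good : Fin n → Fin n → Set
      Good s r = T ((L ─ᵇ R) s) × T (R r) × ¬ T (r ∥ s) × ¬ col r ≡ col s

      removable-from-good : ∀ s r → Good s r → Removable k L R
      removable-from-good s r (s∈L─R , r∈R , r∦s , colours) = record
        { pair   = goodPair r s (R⊆L r r∈R) (T-∧⁻ˡ s∈L─R) r∦s colours
        ; snd∉R  = T-not⁻ (T-∧⁻ʳ {L s} s∈L─R)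
        ; covers = λ x x∈L x-tight → ⊥-elim (<⇒≱ (slack x x∈L) x-tight)
        }

      L─R-nonempty : 0 < count (L ─ᵇ R)
      L─R-nonempty = +-cancelˡ-≤ (count (L ∩ᵇ R)) 1 (count (L ─ᵇ R)) (begin
        count (L ∩ᵇ R) + 1                ≤⟨ +-monoˡ-≤ 1 (≤-trans (count-mono (L ∩ᵇ R) R λ y → T-∧⁻ʳ {L y})
                                                                  R-small) ⟩
        suc k + 1                         ≡⟨ +-comm (suc k) 1 ⟩
        suc (suc k)                       ≤⟨ s≤s (s≤s (m≤n+m k t)) ⟩
        k + k                             ≤⟨ large ⟩
        count L                           ≡⟨ count-split L R ⟨
        count (L ∩ᵇ R) + count (L ─ᵇ R)   ∎)
        where open ≤-Reasoning

      3≤R : 3 ≤ count R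
      3≤R = ≤-trans (s≤s (s≤s (s≤s z≤n))) colourful

      no-good-pair-impossible : (∀ s r → ¬ Good s r) → ⊥
      no-good-pair-impossible bad = <⇒≱ (slack s₀ s₀∈L) (≤-trans np≤1 (s≤s z≤n))
        where
        s₀ = proj₁ (count>0⇒nonempty (L ─ᵇ R) L─R-nonempty)
        s₀∈L─R = proj₂ (count>0⇒nonempty (L ─ᵇ R) L─R-nonempty)
        s₀∈L = T-∧⁻ˡ s₀∈L─R
        forced : ∀ s r → T ((L ─ᵇ R) s) → T (R r) → ¬ col r ≡ col s → T (r ∥ s)
        forced s r s∈L─R r∈R colours = decidable-stable (T? (r ∥ s)) λ r∦s →
          bad s r (s∈L─R , r∈R , r∦s , colours)
        np⊆R-of-colour : ∀ y → T (nonparallel L s₀ y) → T (R y) × col y ≡ col s₀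
        np⊆R-of-colour y y∈np with T? (R y)
        ... | yes y∈R = y∈R , decidable-stable (col y ≟ᶠ col s₀) λ colours →
                          s₀∦y (∥-sym y s₀ (forced s₀ y s₀∈L─R y∈R colours))
          where s₀∦y = T-not⁻ (T-∧⁻ʳ {L y} y∈np)
        ... | no y∉R
          with r , r∈R , r≁s₀ , r≁y ← rainbow-avoids-two-colours rainbow 3≤R (col s₀) (col y)
          = ⊥-elim (T-not⁻ (T-∧⁻ʳ {L y} y∈np) (∥-trans s₀ r y
              (∥-sym r s₀ (forced s₀ r s₀∈L─R r∈R r≁s₀))
              (forced y r (T-∧⁺ (T-∧⁻ˡ y∈np) (T-not⁺ y∉R)) r∈R r≁y)))
        np≤1 : count (nonparallel L s₀) ≤ 1
        np≤1 = rainbow-monochromatic rainbow (λ y → proj₁ ∘ np⊆R-of-colour y) (col s₀)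
                                                (λ y → proj₂ ∘ np⊆R-of-colour y)

      removable : Removable k L R
      removable with any? (λ s → any? (λ r → T? ((L ─ᵇ R) s) ×-dec T? (R r) ×-dec ¬? (T? (r ∥ s))
                                          ×-dec ¬? (col r ≟ᶠ col s)))
      ... | yes (s , r , good) = removable-from-good s r good
      ... | no ∄good = ⊥-elim (no-good-pair-impossible λ s r good → ∄good (s , r , good))

    removable : Removable k L R
    removable with any? (λ x → T? (L x) ×-dec (count (nonparallel L x) ≤? k))
    ... | yes (x₀ , x₀∈L , tight) = Tight.removable x₀ x₀∈L tight
    ... | no ∄tight = Slack.removable λ x x∈L → ≰⇒> λ tight → ∄tight (x , x∈L , tight)

  pairing : ∀ t {L R} → Pairable t L R → DisjointGoodPairs t L
  pairing zero          H = (λ ()) , λ ()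
  pairing (suc zero)    H = single (goodPair-from-two-colours H)
  pairing (suc (suc t)) {L} {R} H =
    extend pair L'⊆L L'-avoids-pair (pairing (suc t) remaining)
    where
    open Pairable H
    R₀ = prefix R (suc (suc (suc t)))
    H₀ : Pairable (suc (suc t)) L R₀
    H₀ = record
      { large     = large
      ; spread    = spread
      ; R⊆L       = λ y → R⊆L y ∘ T-∧⁻ˡ
      ; rainbow   = λ x y x∈R₀ y∈R₀ → rainbow x y (T-∧⁻ˡ x∈R₀) (T-∧⁻ˡ y∈R₀)
      ; colourful = count-prefix≥ R _ colourful
      }
    D = FindRemovable.removable H₀ (count-prefix≤ R _)
    open Removable D using (pair)
    open Removal H₀ D

pair : ∀ {n} → Fin n → Fin n → Subset n
pair u v = ⁅ u ⁆ ∪ ⁅ v ⁆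

∈-pair⁻ : ∀ {n} {u v x : Fin n} → x ∈ pair u v → x ≡ u ⊎ x ≡ v
∈-pair⁻ {u = u} {v} = map-⊎ (x∈⁅y⁆⇒x≡y u) (x∈⁅y⁆⇒x≡y v) ∘ x∈p∪q⁻ ⁅ u ⁆ ⁅ v ⁆

∈-pair⁺ : ∀ {n} {u v x : Fin n} → x ≡ u ⊎ x ≡ v → x ∈ pair u v
∈-pair⁺ {u = u} (inj₁ refl) = x∈p∪q⁺ (inj₁ (x∈⁅x⁆ u))
∈-pair⁺ {v = v} (inj₂ refl) = x∈p∪q⁺ (inj₂ (x∈⁅x⁆ v))

∣p∪q∣≤∣p∣+∣q∣ : ∀ {n} (p q : Subset n) → ∣ p ∪ q ∣ ≤ ∣ p ∣ + ∣ q ∣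
∣p∪q∣≤∣p∣+∣q∣ []          []          = z≤n
∣p∪q∣≤∣p∣+∣q∣ (true ∷ p)  (b ∷ q)     =
  s≤s (≤-trans (∣p∪q∣≤∣p∣+∣q∣ p q) (+-monoʳ-≤ ∣ p ∣ (∣p∣≤∣x∷p∣ b q)))
∣p∪q∣≤∣p∣+∣q∣ (false ∷ p) (true ∷ q)  =
  ≤-trans (s≤s (∣p∪q∣≤∣p∣+∣q∣ p q)) (≤-reflexive (sym (+-suc ∣ p ∣ ∣ q ∣)))
∣p∪q∣≤∣p∣+∣q∣ (false ∷ p) (false ∷ q) = ∣p∪q∣≤∣p∣+∣q∣ p q

∣pair∣≤2 : ∀ {n} (u v : Fin n) → ∣ pair u v ∣ ≤ 2
∣pair∣≤2 u v = ≤-trans (∣p∪q∣≤∣p∣+∣q∣ ⁅ u ⁆ ⁅ v ⁆) (≤-reflexive (cong₂ _+_ (∣⁅x⁆∣≡1 u) (∣⁅x⁆∣≡1 v)))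

pair-comm : ∀ {n} (u v : Fin n) → pair u v ⊆ pair v u
pair-comm u v = ∈-pair⁺ ∘ swap ∘ ∈-pair⁻

Disjoint : ∀ {n t} → (Fin t → Subset n) → Set
Disjoint Bs = ∀ i j x → x ∈ Bs i → x ∈ Bs j → i ≡ j

disjoint-picks≤count : ∀ {n t} (p : Fin n → Bool) (Bs : Fin t → Subset n) → Disjoint Bs →
                       (∀ i → ∃ λ x → x ∈ Bs i × T (p x)) → t ≤ count p
disjoint-picks≤count p Bs disjoint pick =
  injective⇒≤count p (proj₁ ∘ pick) x-injective (proj₂ ∘ proj₂ ∘ pick)
  where
  x∈B : ∀ i → proj₁ (pick i) ∈ Bs i
  x∈B = proj₁ ∘ proj₂ ∘ pick
  x-injective : ∀ i j → proj₁ (pick i) ≡ proj₁ (pick j) → i ≡ j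
  x-injective i j e = disjoint i j _ (x∈B i) (subst (_∈ Bs j) (sym e) (x∈B j))

disjoint-double-picks≤count : ∀ {n t} (p : Fin n → Bool) (Bs : Fin t → Subset n) → Disjoint Bs →
                              (x₁ x₂ : Fin t → Fin n) → (∀ i → x₁ i ∈ Bs i × x₂ i ∈ Bs i) →
                              (∀ i → ¬ x₁ i ≡ x₂ i) → (∀ i → T (p (x₁ i)) × T (p (x₂ i))) →
                              t + t ≤ count p
disjoint-double-picks≤count {t = t} p Bs disjoint x₁ x₂ x∈B x₁≢x₂ px =
  injective⇒≤count p (x ∘ splitAt t)
    (λ k k' → splitAt-injective k k' ∘ x-injective (splitAt t k) (splitAt t k'))
    (px' ∘ splitAt t)
  where
  x : Fin t ⊎ Fin t → _
  x = [ x₁ , x₂ ]′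
  px' : ∀ s → T (p (x s))
  px' (inj₁ i) = proj₁ (px i)
  px' (inj₂ i) = proj₂ (px i)
  owner : Fin t ⊎ Fin t → Fin t
  owner = [ id , id ]′
  x∈owner : ∀ s → x s ∈ Bs (owner s)
  x∈owner (inj₁ i) = proj₁ (x∈B i)
  x∈owner (inj₂ i) = proj₂ (x∈B i)
  same-owner : ∀ s s' → x s ≡ x s' → owner s ≡ owner s'
  same-owner s s' e = disjoint _ _ _ (x∈owner s) (subst (_∈ Bs (owner s')) (sym e) (x∈owner s'))
  x-injective : ∀ s s' → x s ≡ x s' → s ≡ s'
  x-injective (inj₁ i) (inj₁ j) e = cong inj₁ (same-owner (inj₁ i) (inj₁ j) e)
  x-injective (inj₂ i) (inj₂ j) e = cong inj₂ (same-owner (inj₂ i) (inj₂ j) e)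
  x-injective (inj₁ i) (inj₂ j) e with refl ← same-owner (inj₁ i) (inj₂ j) e = ⊥-elim (x₁≢x₂ i e)
  x-injective (inj₂ i) (inj₁ j) e with refl ← same-owner (inj₂ i) (inj₁ j) e = ⊥-elim (x₁≢x₂ i (sym e))
  splitAt-injective : ∀ k k' → splitAt t k ≡ splitAt t k' → k ≡ k'
  splitAt-injective k k' e =
    trans (sym (join-splitAt t t k)) (trans (cong (join t t) e) (join-splitAt t t k'))

surjective⇒section : ∀ {n m} (c : Fin n → Fin m) → Surjective _≡_ _≡_ c →
                     Σ (Fin m → Fin n) λ g → ∀ j → c (g j) ≡ j
surjective⇒section c surj = (λ j → proj₁ (surj j)) , (λ j → proj₂ (surj j) refl)

section-injective : ∀ {n m} {c : Fin n → Fin m} (g : Fin m → Fin n) → (∀ j → c (g j) ≡ j) →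
                    ∀ i j → g i ≡ g j → i ≡ j
section-injective {c = c} g cg i j e = trans (sym (cg i)) (trans (cong c e) (cg j))

surjective⇒≤ : ∀ {n m} (c : Fin n → Fin m) → Surjective _≡_ _≡_ c → m ≤ n
surjective⇒≤ c surj with g , cg ← surjective⇒section c surj =
  injective⇒≤ (section-injective {c = c} g cg _ _)

module MatroidProperties {n : ℕ} (M : Matroid n) where
  open Matroid M

  r-singleton≤1 : ∀ x → r ⁅ x ⁆ ≤ 1
  r-singleton≤1 x = ≤-trans (r-bound ⁅ x ⁆) (≤-reflexive (∣⁅x⁆∣≡1 x))

  r-pair≤ : ∀ u v → r (pair u v) ≤ r ⁅ u ⁆ + r ⁅ v ⁆
  r-pair≤ u v = ≤-trans (m≤m+n _ _) (r-submod ⁅ u ⁆ ⁅ v ⁆)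

  r-pair-in-closure : ∀ S u v → r (S ∪ ⁅ u ⁆) ≤ r S → r (S ∪ ⁅ v ⁆) ≤ r S → r (pair u v) ≤ r S
  r-pair-in-closure S u v u∈clS v∈clS = +-cancelʳ-≤ (r S) (r (pair u v)) (r S) (begin
    r (pair u v) + r S           ≤⟨ +-mono-≤ (r-mono _ _ pair⊆X∪Y) (r-mono _ _ S⊆X∩Y) ⟩
    r (X ∪ Y) + r (X ∩ Y)        ≤⟨ r-submod X Y ⟩
    r X + r Y                    ≤⟨ +-mono-≤ u∈clS v∈clS ⟩
    r S + r S                    ∎)
    where
    open ≤-Reasoning
    X = S ∪ ⁅ u ⁆
    Y = S ∪ ⁅ v ⁆
    pair⊆X∪Y : pair u v ⊆ X ∪ Y
    pair⊆X∪Y = x∈p∪q⁺ ∘ map-⊎ (x∈p∪q⁺ ∘ inj₂) (x∈p∪q⁺ ∘ inj₂) ∘ x∈p∪q⁻ ⁅ u ⁆ ⁅ v ⁆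
    S⊆X∩Y : S ⊆ X ∩ Y
    S⊆X∩Y x∈S = x∈p∩q⁺ (x∈p∪q⁺ (inj₁ x∈S) , x∈p∪q⁺ (inj₁ x∈S))

  loop nonloop : Fin n → Bool
  loop x    = does (r ⁅ x ⁆ ≟ 0)
  nonloop x = not (loop x)

  nonloop⇒r≡1 : ∀ x → T (nonloop x) → r ⁅ x ⁆ ≡ 1
  nonloop⇒r≡1 x x-nonloop = ≤-antisym (r-singleton≤1 x) (n≢0⇒n>0 (not-does⁻ (r ⁅ x ⁆ ≟ 0) x-nonloop))

  2≤r-pair⇒nonloops : ∀ u v → 2 ≤ r (pair u v) → T (nonloop u) × T (nonloop v)
  2≤r-pair⇒nonloops u v 2≤r =
    nonloop-of u v 2≤r , nonloop-of v u (≤-trans 2≤r (r-mono _ _ (pair-comm u v)))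
    where
    nonloop-of : ∀ u v → 2 ≤ r (pair u v) → T (nonloop u)
    nonloop-of u v 2≤r = not-does⁺ (r ⁅ u ⁆ ≟ 0) λ r≡0 → <⇒≱ 2≤r (begin
      r (pair u v)          ≤⟨ r-pair≤ u v ⟩
      r ⁅ u ⁆ + r ⁅ v ⁆     ≤⟨ +-mono-≤ (≤-reflexive r≡0) (r-singleton≤1 v) ⟩
      1                     ∎)
      where open ≤-Reasoning

  2≤r-pair⇒distinct : ∀ u v → 2 ≤ r (pair u v) → ¬ u ≡ v
  2≤r-pair⇒distinct u .u 2≤r refl =
    <⇒≱ 2≤r (≤-trans (r-mono (pair u u) ⁅ u ⁆ (λ x∈uu → [ (λ { refl → x∈⁅x⁆ u }) , (λ { refl → x∈⁅x⁆ u }) ]′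
                                                       (∈-pair⁻ x∈uu)))
                     (r-singleton≤1 u))

  -- Restricted to nonloops, parallelism is transitive.
  Parallel : Fin n → Fin n → Set
  Parallel x y = T (nonloop x) × T (nonloop y) × r (pair x y) ≤ 1

  parallel? : ∀ x y → Dec (Parallel x y)
  parallel? x y = T? (nonloop x) ×-dec T? (nonloop y) ×-dec (r (pair x y) ≤? 1)

  _∥_ : Fin n → Fin n → Bool
  x ∥ y = does (parallel? x y)

  ∥-sym : ∀ x y → T (x ∥ y) → T (y ∥ x)
  ∥-sym x y x∥y with does⁻ (parallel? x y) x∥y
  ... | x-nonloop , y-nonloop , r≤1 =
    does⁺ (parallel? y x) (y-nonloop , x-nonloop , ≤-trans (r-mono _ _ (pair-comm y x)) r≤1)

  ∥-trans : ∀ x y z → T (x ∥ y) → T (y ∥ z) → T (x ∥ z)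
  ∥-trans x y z x∥y y∥z with does⁻ (parallel? x y) x∥y | does⁻ (parallel? y z) y∥z
  ... | x-nonloop , y-nonloop , r-xy≤1 | _ , z-nonloop , r-yz≤1 =
    does⁺ (parallel? x z) (x-nonloop , z-nonloop , ≤-trans
      (r-pair-in-closure ⁅ y ⁆ x z (in-closure r-yx≤1) (in-closure r-yz≤1)) (r-singleton≤1 y))
    where
    r-yx≤1 = ≤-trans (r-mono _ _ (pair-comm y x)) r-xy≤1
    in-closure : ∀ {w} → r (pair y w) ≤ 1 → r (pair y w) ≤ r ⁅ y ⁆
    in-closure r≤1 = ≤-trans r≤1 (≤-reflexive (sym (nonloop⇒r≡1 y y-nonloop)))

  inClosure : Fin n → Fin n → Bool
  inClosure x y = does (r (⁅ x ⁆ ∪ ⁅ y ⁆) ≟ r ⁅ x ⁆)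

  ∣M₀∣+nonloops≡n : ∣ M₀ M ∣ + count nonloop ≡ n
  ∣M₀∣+nonloops≡n = trans (cong (_+ count nonloop) (∣tabulate∣ loop)) (count-complement loop)

  ∣cl∣+outside≡n : ∀ x → ∣ cl M ⁅ x ⁆ ∣ + count (not ∘ inClosure x) ≡ n
  ∣cl∣+outside≡n x =
    trans (cong (_+ count (not ∘ inClosure x)) (∣tabulate∣ (inClosure x))) (count-complement (inClosure x))

  outside-closure⇒nonparallel : ∀ x → T (nonloop x) → not ∘ inClosure x ⊆ᵇ nonloop ─ᵇ (x ∥_)
  outside-closure⇒nonparallel x x-nonloop y y∉cl = T-∧⁺ y-nonloop (not-does⁺ (parallel? x y) x∦y)
    where
    r-grows : ¬ r (pair x y) ≡ r ⁅ x ⁆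
    r-grows = not-does⁻ (r (pair x y) ≟ r ⁅ x ⁆) y∉cl
    r-x≤r-xy : r ⁅ x ⁆ ≤ r (pair x y)
    r-x≤r-xy = r-mono _ _ (x∈p∪q⁺ ∘ inj₁)
    y-nonloop : T (nonloop y)
    y-nonloop = not-does⁺ (r ⁅ y ⁆ ≟ 0) λ r≡0 → r-grows (≤-antisym (begin
      r (pair x y)          ≤⟨ r-pair≤ x y ⟩
      r ⁅ x ⁆ + r ⁅ y ⁆     ≡⟨ cong (r ⁅ x ⁆ +_) r≡0 ⟩
      r ⁅ x ⁆ + 0           ≡⟨ +-identityʳ _ ⟩
      r ⁅ x ⁆               ∎) r-x≤r-xy)
      where open ≤-Reasoning
    x∦y : ¬ Parallel x y
    x∦y (_ , _ , r≤1) =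
      r-grows (≤-antisym (≤-trans r≤1 (≤-reflexive (sym (nonloop⇒r≡1 x x-nonloop)))) r-x≤r-xy)

2*t≡t+t : ∀ t → 2 * t ≡ t + t
2*t≡t+t t = cong (t +_) (+-identityʳ t)

module RankTwo {n : ℕ} (M : Matroid n) (rank≡2 : rank M ≡ 2) where
  open Matroid M
  open MatroidProperties M

  r≤2 : ∀ X → r X ≤ 2
  r≤2 X = ≤-trans (r-mono X ⊤ (λ _ → ∈⊤)) (≤-reflexive rank≡2)

  record SpanningPair (B : Subset n) : Set where
    constructor spanningPair
    field
      u v    : Fin n
      u∈B    : u ∈ B
      v∈B    : v ∈ B
      2≤r-uv : 2 ≤ r (pair u v)

  basis⇒spanning-pair : ∀ {B} → IsBasis M B → SpanningPair B
  basis⇒spanning-pair {B} (r≡∣B∣ , ∣B∣≡rank) =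
    spanning (two-elements (lookup B) (≤-reflexive (sym count≡2)))
    where
    ∣B∣≡2 : ∣ B ∣ ≡ 2
    ∣B∣≡2 = trans ∣B∣≡rank rank≡2
    count≡2 : count (lookup B) ≡ 2
    count≡2 = trans (sym (∣∣≡count-lookup B)) ∣B∣≡2
    spanning : (∃ λ u → ∃ λ v → T (lookup B u) × T (lookup B v) × ¬ u ≡ v) → SpanningPair B
    spanning (u , v , u∈B , v∈B , u≢v) = spanningPair u v (T-lookup⇒∈ u∈B) (T-lookup⇒∈ v∈B) (begin
      2             ≡⟨ trans (sym ∣B∣≡2) (sym r≡∣B∣) ⟩
      r B           ≤⟨ r-mono _ _ B⊆pair ⟩
      r (pair u v)  ∎)
      where
      open ≤-Reasoning
      B⊆pair : B ⊆ pair u v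
      B⊆pair {y} y∈B with y ≟ᶠ u | y ≟ᶠ v
      ... | yes y≡u | _       = ∈-pair⁺ (inj₁ y≡u)
      ... | no _    | yes y≡v = ∈-pair⁺ (inj₂ y≡v)
      ... | no y≢u  | no y≢v  = ⊥-elim (<⇒≱ (≤-reflexive refl) (begin
        3                                      ≤⟨ s≤s (s≤s (∈⇒count>0 _ y (∈-remove⁺ (lookup B -ᵇ u) y≢v
                                                    (∈-remove⁺ (lookup B) y≢u (∈⇒T-lookup y∈B))))) ⟩
        suc (suc (count (lookup B -ᵇ u -ᵇ v))) ≡⟨ cong suc (count-remove (lookup B -ᵇ u) v
                                                    (∈-remove⁺ (lookup B) (u≢v ∘ sym) v∈B)) ⟨
        suc (count (lookup B -ᵇ u))            ≡⟨ count-remove (lookup B) u u∈B ⟨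
        count (lookup B)                       ≡⟨ count≡2 ⟩
        2                                      ∎))

  nonparallel-pair-basis : ∀ u v → T (nonloop u) → T (nonloop v) → ¬ T (u ∥ v) →
                           IsBasis M (pair u v)
  nonparallel-pair-basis u v u-nonloop v-nonloop u∦v =
    trans r≡2 (sym ∣pair∣≡2) , trans ∣pair∣≡2 (sym rank≡2)
    where
    2≤r : 2 ≤ r (pair u v)
    2≤r = ≰⇒> λ r≤1 → u∦v (does⁺ (parallel? u v) (u-nonloop , v-nonloop , r≤1))
    r≡2 : r (pair u v) ≡ 2
    r≡2 = ≤-antisym (r≤2 _) 2≤r
    ∣pair∣≡2 : ∣ pair u v ∣ ≡ 2
    ∣pair∣≡2 = ≤-antisym (∣pair∣≤2 u v) (≤-trans 2≤r (r-bound _))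

  basis-outside-closure : ∀ {B} → IsBasis M B → ∀ x → ∃ λ y → y ∈ B × T (not (inClosure x y))
  basis-outside-closure B-basis x with basis⇒spanning-pair B-basis
  ... | spanningPair u v u∈B v∈B 2≤r-uv with T? (inClosure x u) | T? (inClosure x v)
  ...   | no u∉cl  | _        = u , u∈B , T-not⁺ u∉cl
  ...   | yes _    | no v∉cl  = v , v∈B , T-not⁺ v∉cl
  ...   | yes u∈cl | yes v∈cl = ⊥-elim (<⇒≱ 2≤r-uv (≤-trans
          (r-pair-in-closure ⁅ x ⁆ u v (≤-reflexive (does⁻ (r (pair x u) ≟ r ⁅ x ⁆) u∈cl))
                                       (≤-reflexive (does⁻ (r (pair x v) ≟ r ⁅ x ⁆) v∈cl)))
          (r-singleton≤1 x)))

  disjoint-bases⇒nonloops : ∀ {t} (Bs : Fin t → Subset n) → (∀ i → IsBasis M (Bs i)) → Disjoint Bs →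
                            t + t ≤ count nonloop
  disjoint-bases⇒nonloops Bs Bs-bases disjoint =
    disjoint-double-picks≤count nonloop Bs disjoint (u ∘ sp) (v ∘ sp) (λ i → u∈B (sp i) , v∈B (sp i))
      (λ i → 2≤r-pair⇒distinct _ _ (2≤r-uv (sp i))) (λ i → 2≤r-pair⇒nonloops _ _ (2≤r-uv (sp i)))
    where
    open SpanningPair
    sp = λ i → basis⇒spanning-pair (Bs-bases i)

  first-case⇒no-disjoint-bases : ∀ t → FirstCase M t → ∀ {m} (c : Fin n → Fin m) →
                                 ¬ HasDisjointRainbowBases M c t
  first-case⇒no-disjoint-bases t (inj₁ few-nonloops) c (Bs , rainbow-bases , disjoint) =
    <⇒≱ few-nonloops (begin
      ∣ M₀ M ∣ + 2 * t            ≡⟨ cong (∣ M₀ M ∣ +_) (2*t≡t+t t) ⟩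
      ∣ M₀ M ∣ + (t + t)          ≤⟨ +-monoʳ-≤ ∣ M₀ M ∣
                                       (disjoint-bases⇒nonloops Bs (proj₁ ∘ rainbow-bases) disjoint) ⟩
      ∣ M₀ M ∣ + count nonloop    ≡⟨ ∣M₀∣+nonloops≡n ⟩
      n                           ∎)
    where open ≤-Reasoning
  first-case⇒no-disjoint-bases t (inj₂ (x , large-closure)) c (Bs , rainbow-bases , disjoint) =
    <⇒≱ large-closure (begin
      ∣ cl M ⁅ x ⁆ ∣ + t                            ≤⟨ +-monoʳ-≤ ∣ cl M ⁅ x ⁆ ∣ (disjoint-picks≤count _ Bs disjoint
                                                         λ i → basis-outside-closure (proj₁ (rainbow-bases i)) x) ⟩
      ∣ cl M ⁅ x ⁆ ∣ + count (not ∘ inClosure x)    ≡⟨ ∣cl∣+outside≡n x ⟩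
      n                                             ∎)
    where open ≤-Reasoning

  not-first-case⇒nonloops : ∀ t → ¬ FirstCase M t → t + t ≤ count nonloop
  not-first-case⇒nonloops t ¬first = +-cancelˡ-≤ ∣ M₀ M ∣ (t + t) (count nonloop) (begin
    ∣ M₀ M ∣ + (t + t)          ≡⟨ cong (∣ M₀ M ∣ +_) (2*t≡t+t t) ⟨
    ∣ M₀ M ∣ + 2 * t            ≤⟨ ≮⇒≥ (¬first ∘ inj₁) ⟩
    n                           ≡⟨ ∣M₀∣+nonloops≡n ⟨
    ∣ M₀ M ∣ + count nonloop    ∎)
    where open ≤-Reasoning

  not-first-case⇒spread : ∀ t → ¬ FirstCase M t → ∀ x → T (nonloop x) →
                          t ≤ count (nonloop ─ᵇ (x ∥_))
  not-first-case⇒spread t ¬first x x-nonloop = ≤-trans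
    (+-cancelˡ-≤ ∣ cl M ⁅ x ⁆ ∣ t _ (begin
      ∣ cl M ⁅ x ⁆ ∣ + t                           ≤⟨ ≮⇒≥ (¬first ∘ inj₂ ∘ (x ,_)) ⟩
      n                                            ≡⟨ ∣cl∣+outside≡n x ⟨
      ∣ cl M ⁅ x ⁆ ∣ + count (not ∘ inClosure x)   ∎))
    (count-mono _ _ (outside-closure⇒nonparallel x x-nonloop))
    where open ≤-Reasoning

  -- All nonloops after the first t share one colour, so every rainbow basis uses one of the first t.
  module LowerColouring (t : ℕ) (nonloops-large : suc t ≤ count nonloop) where
    colour : Fin n → ℕ
    colour y = if loop y then position loop y else ∣ M₀ M ∣ + (position nonloop y ⊓ t)

    colour-loop : ∀ y → T (loop y) → colour y ≡ position loop y
    colour-loop y y-loop with loop y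
    ... | true = refl

    colour-nonloop : ∀ y → T (nonloop y) → colour y ≡ ∣ M₀ M ∣ + (position nonloop y ⊓ t)
    colour-nonloop y y-nonloop with loop y
    ... | false = refl

    colour< : ∀ y → colour y < ∣ M₀ M ∣ + suc t
    colour< y with T? (loop y)
    ... | yes y-loop = begin-strict
      colour y              ≡⟨ colour-loop y y-loop ⟩
      position loop y       <⟨ position<count loop y y-loop ⟩
      count loop            ≡⟨ ∣tabulate∣ loop ⟨
      ∣ M₀ M ∣              ≤⟨ m≤m+n ∣ M₀ M ∣ (suc t) ⟩
      ∣ M₀ M ∣ + suc t      ∎
      where open ≤-Reasoning
    ... | no y-nonloop = begin-strict
      colour y                                   ≡⟨ colour-nonloop y (T-not⁺ y-nonloop) ⟩
      ∣ M₀ M ∣ + (position nonloop y ⊓ t)        <⟨ +-monoʳ-< ∣ M₀ M ∣ (s≤s (m⊓n≤n _ t)) ⟩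
      ∣ M₀ M ∣ + suc t                           ∎
      where open ≤-Reasoning

    colouring : Fin n → Fin (∣ M₀ M ∣ + suc t)
    colouring y = fromℕ< (colour< y)

    loop-colours-hit : ∀ d → d < ∣ M₀ M ∣ → ∃ λ y → toℕ (colouring y) ≡ d
    loop-colours-hit d d<∣M₀∣
      with y , y-loop , pos≡d ← position-surjective loop d (subst (d <_) (∣tabulate∣ loop) d<∣M₀∣)
      = y , trans (toℕ-fromℕ< _) (trans (colour-loop y y-loop) pos≡d)

    nonloop-colours-hit : ∀ d → d < suc t → ∃ λ y → toℕ (colouring y) ≡ ∣ M₀ M ∣ + d
    nonloop-colours-hit d d<1+t
      with y , y-nonloop , pos≡d ← position-surjective nonloop d (≤-trans d<1+t nonloops-large)
      = y , (begin
          toℕ (colouring y)                    ≡⟨ toℕ-fromℕ< _ ⟩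
          colour y                             ≡⟨ colour-nonloop y y-nonloop ⟩
          ∣ M₀ M ∣ + (position nonloop y ⊓ t)  ≡⟨ cong (λ p → ∣ M₀ M ∣ + (p ⊓ t)) pos≡d ⟩
          ∣ M₀ M ∣ + (d ⊓ t)                   ≡⟨ cong (∣ M₀ M ∣ +_) (m≤n⇒m⊓n≡m (s≤s⁻¹ d<1+t)) ⟩
          ∣ M₀ M ∣ + d                         ∎)
      where open ≡-Reasoning

    offset<1+t : ∀ (j : Fin (∣ M₀ M ∣ + suc t)) → ∣ M₀ M ∣ ≤ toℕ j → toℕ j ∸ ∣ M₀ M ∣ < suc t
    offset<1+t j ∣M₀∣≤j = +-cancelˡ-< ∣ M₀ M ∣ _ (suc t)
      (subst (_< ∣ M₀ M ∣ + suc t) (sym (m+[n∸m]≡n ∣M₀∣≤j)) (toℕ<n j))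

    colouring-surjective : Surjective _≡_ _≡_ colouring
    colouring-surjective j with toℕ j <? ∣ M₀ M ∣
    ... | yes j<∣M₀∣ with y , hit ← loop-colours-hit (toℕ j) j<∣M₀∣ =
      y , λ { refl → toℕ-injective hit }
    ... | no j≮∣M₀∣ with y , hit ← nonloop-colours-hit (toℕ j ∸ ∣ M₀ M ∣) (offset<1+t j (≮⇒≥ j≮∣M₀∣)) =
      y , λ { refl → toℕ-injective (trans hit (m+[n∸m]≡n (≮⇒≥ j≮∣M₀∣))) }

    late-colour : ∀ y → T (nonloop y) → ¬ position nonloop y < t → toℕ (colouring y) ≡ ∣ M₀ M ∣ + t
    late-colour y y-nonloop late = trans (toℕ-fromℕ< _)
      (trans (colour-nonloop y y-nonloop) (cong (∣ M₀ M ∣ +_) (m≥n⇒m⊓n≡n (≮⇒≥ late))))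

    no-rainbow-bases : ¬ HasDisjointRainbowBases M colouring (suc t)
    no-rainbow-bases (Bs , rainbow-bases , disjoint) =
      <⇒≱ (disjoint-picks≤count (prefix nonloop t) Bs disjoint early-element) (count-prefix≤ nonloop t)
      where
      early-element : ∀ i → ∃ λ y → y ∈ Bs i × T (prefix nonloop t y)
      early-element i with basis⇒spanning-pair (proj₁ (rainbow-bases i))
      ... | spanningPair u v u∈B v∈B 2≤r-uv
        with u-nonloop , v-nonloop ← 2≤r-pair⇒nonloops u v 2≤r-uv
        with position nonloop u <? t | position nonloop v <? t
      ...   | yes u-early | _           = u , u∈B , T-∧⁺ u-nonloop (<⇒<ᵇ u-early)
      ...   | no _        | yes v-early = v , v∈B , T-∧⁺ v-nonloop (<⇒<ᵇ v-early)
      ...   | no u-late   | no v-late   = ⊥-elim (2≤r-pair⇒distinct u v 2≤r-uv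
          (proj₂ (rainbow-bases i) u v u∈B v∈B (toℕ-injective
            (trans (late-colour u u-nonloop u-late) (sym (late-colour v v-nonloop v-late))))))

  module UpperBound {t m : ℕ} (c : Fin n → Fin m) (surjective : Surjective _≡_ _≡_ c)
                    (many-colours : ∣ M₀ M ∣ + t < m) (nonloops-large : t + t ≤ count nonloop)
                    (spread : ∀ x → T (nonloop x) → t ≤ count (nonloop ─ᵇ (x ∥_))) where
    open TransversalPairs _∥_ c ∥-sym ∥-trans
    open GoodPair

    g : Fin m → Fin n
    g = proj₁ (surjective⇒section c surjective)

    c∘g≡id : ∀ j → c (g j) ≡ j
    c∘g≡id = proj₂ (surjective⇒section c surjective)

    representative : Fin n → Bool
    representative y = does (any? λ j → g j ≟ᶠ y)

    R : Fin n → Bool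
    R = representative ─ᵇ loop

    R-rainbow : Rainbow R
    R-rainbow x y x∈R y∈R same-colour
      with j , refl ← does⁻ (any? λ j → g j ≟ᶠ x) (T-∧⁻ˡ x∈R)
         | j' , refl ← does⁻ (any? λ j → g j ≟ᶠ y) (T-∧⁻ˡ y∈R)
      = cong g (trans (sym (c∘g≡id j)) (trans same-colour (c∘g≡id j')))

    R-colourful : suc t ≤ count R
    R-colourful = +-cancelˡ-≤ ∣ M₀ M ∣ (suc t) (count R) (begin
      ∣ M₀ M ∣ + suc t                                   ≡⟨ +-suc ∣ M₀ M ∣ t ⟩
      suc (∣ M₀ M ∣ + t)                                 ≤⟨ many-colours ⟩
      m                                                  ≤⟨ injective⇒≤count representative g
                                                              (section-injective {c = c} g c∘g≡id)
                                                              (λ j → does⁺ (any? λ i → g i ≟ᶠ g j)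
                                                                           (j , refl)) ⟩
      count representative                               ≡⟨ count-split representative loop ⟨
      count (representative ∩ᵇ loop) + count R           ≤⟨ +-monoˡ-≤ (count R)
                                                              (count-mono _ loop λ y → T-∧⁻ʳ {representative y}) ⟩
      count loop + count R                               ≡⟨ cong (_+ count R) (∣tabulate∣ loop) ⟨
      ∣ M₀ M ∣ + count R                                 ∎)
      where open ≤-Reasoning

    pairs : DisjointGoodPairs t nonloop
    pairs = pairing t record
      { large     = nonloops-large
      ; spread    = spread
      ; R⊆L       = λ y → T-∧⁻ʳ {representative y}
      ; rainbow   = R-rainbow
      ; colourful = R-colourful
      }

    rainbow-bases : HasDisjointRainbowBases M c t
    rainbow-bases = (λ i → pair (fst (P i)) (snd (P i))) , (λ i → basis i , rainbow i) , disjoint'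
      where
      P = proj₁ pairs
      basis : ∀ i → IsBasis M (pair (fst (P i)) (snd (P i)))
      basis i = nonparallel-pair-basis _ _ (fst∈L (P i)) (snd∈L (P i)) (fst∦snd (P i))
      rainbow : ∀ i x y → x ∈ pair (fst (P i)) (snd (P i)) → y ∈ pair (fst (P i)) (snd (P i)) →
                c x ≡ c y → x ≡ y
      rainbow i x y x∈ y∈ same-colour with ∈-pair⁻ x∈ | ∈-pair⁻ y∈
      ... | inj₁ refl | inj₁ refl = refl
      ... | inj₂ refl | inj₂ refl = refl
      ... | inj₁ refl | inj₂ refl = ⊥-elim (colours-differ (P i) same-colour)
      ... | inj₂ refl | inj₁ refl = ⊥-elim (colours-differ (P i) (sym same-colour))
      disjoint' : Disjoint (λ i → pair (fst (P i)) (snd (P i)))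
      disjoint' i j x x∈i x∈j = proj₂ pairs i j x (∈-pair⁻ x∈i) (∈-pair⁻ x∈j)

corollary5 : (n : ℕ) (M : Matroid n) → rank M ≡ 2 → (t : ℕ) → 1 ≤ t →
    (FirstCase M t → ArEq M t n) × (¬ FirstCase M t → ArEq M t (∣ M₀ M ∣ + t))
corollary5 n M rank≡2 (suc t) _ = first-case , second-case
  where
  open MatroidProperties M
  open RankTwo M rank≡2

  first-case : FirstCase M (suc t) → ArEq M (suc t) n
  first-case first =
    (id , (λ j → j , λ z≡j → z≡j) , first-case⇒no-disjoint-bases (suc t) first id) ,
    λ m (c , surjective , _) → surjective⇒≤ c surjective

  second-case : ¬ FirstCase M (suc t) → ArEq M (suc t) (∣ M₀ M ∣ + suc t)
  second-case ¬first = (colouring , colouring-surjective , no-rainbow-bases) , at-most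
    where
    nonloops-large = not-first-case⇒nonloops (suc t) ¬first
    open LowerColouring t (≤-trans (m≤m+n (suc t) (suc t)) nonloops-large)
    at-most : ∀ m → Admissible M (suc t) m → m ≤ ∣ M₀ M ∣ + suc t
    at-most m (c , surjective , no-bases) = ≮⇒≥ λ many-colours → no-bases
      (UpperBound.rainbow-bases c surjective many-colours nonloops-large
                                (not-first-case⇒spread (suc t) ¬first))
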